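{- Let $k\ge1$ and $n\ge1$. The descending strictly $k$-Naples parking functions of length $n$ are in bijection with the binary trees with $n+k$ nodes satisfying: the root has at least $k-1$ left children in a row, the root has a right child, and this right child has at least $k$ left children in a row.
   Context: Binary trees are rooted trees in which each vertex has at most two children, each child being designated as a left or right child (at most one of each). A vertex $v$ has at least $m$ left children in a row if there are vertices $v=v_0,v_1,\dots,v_m$ with $v_j$ the left child of $v_{j-1}$ for $j=1,\dots,m$. Parking rules: $n$ spots $1,\dots,n$; cars $c_1,\dots,c_n$ arrive in order with preferences $a_j\in[n]$; $k$-Naples rule: $c_j$ parks at $a_j$ if empty, otherwise checks spots $a_j-1,\dots,a_j-k$ (those $\ge1$) in order and parks in the first empty one, otherwise drives forward from $a_j$ and parks in the first empty spot after $a_j$ (failing if none). A preference is a $k$-Naples parking function if all cars park ($0$-Naples = ordinary parking functions); it is strictly $k$-Naples if it is $k$-Naples but not $(k-1)$-Naples. Descending means weakly decreasing. -}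

module Defs where

open import Data.Nat using (ℕ; zero; suc; _+_; _∸_; _≤_; _<_; _≥_; _≡ᵇ_; _<ᵇ_)
open import Data.Bool using (Bool; true; false; not; _∧_; if_then_else_; T)
open import Data.List using (List; []; _∷_; _++_; map; upTo; filterᵇ)
open import Data.Bool.ListAction using (any)
open import Data.Maybe using (Maybe; just; nothing; is-just)
open import Data.Vec using (Vec; toList)
open import Data.Vec.Relation.Unary.All using (All)
open import Data.List.Relation.Unary.Linked using (Linked)
open import Data.Product using (Σ; _×_)
open import Data.Unit using (⊤)
open import Data.Empty using (⊥)
open import Relation.Binary.PropositionalEquality using (_≡_)

-- Parking (spots are the numbers 1..n; the state is the list of
-- occupied spots)

occupied : List ℕ → ℕ → Bool
occupied occ s = any (λ x → x ≡ᵇ s) occ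

firstFree : List ℕ → List ℕ → Maybe ℕ
firstFree occ []       = nothing
firstFree occ (s ∷ ss) = if occupied occ s then firstFree occ ss else just s

-- spots a-1, a-2, ..., a-k, keeping only those ≥ 1, in this order
backSpots : ℕ → ℕ → List ℕ
backSpots k a = map (λ j → a ∸ suc j) (filterᵇ (λ j → suc j <ᵇ a) (upTo k))

forwardSpots : ℕ → ℕ → List ℕ
forwardSpots n a = map (λ j → a + suc j) (upTo (n ∸ a))

parkCar : ℕ → ℕ → List ℕ → ℕ → Maybe ℕ
parkCar k n occ a =
  if occupied occ a then firstFree occ (backSpots k a ++ forwardSpots n a)
  else just a

runNaples : ℕ → ℕ → List ℕ → List ℕ → Maybe (List ℕ)
runNaples k n occ []       = just occ
runNaples k n occ (a ∷ as) with parkCar k n occ a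
... | nothing = nothing
... | just s  = runNaples k n (s ∷ occ) as

isNaples : ℕ → ℕ → List ℕ → Bool
isNaples k n as = is-just (runNaples k n [] as)

isStrictlyNaples : ℕ → ℕ → List ℕ → Bool
isStrictlyNaples k n as = isNaples k n as ∧ not (isNaples (k ∸ 1) n as)

DescStrictNaplesPF : ℕ → ℕ → Set
DescStrictNaplesPF k n =
  Σ (Vec ℕ n) λ a →
    All (λ x → 1 ≤ x × x ≤ n) a
    × Linked _≥_ (toList a)
    × T (isStrictlyNaples k n (toList a))

data Tree : Set where
  leaf : Tree
  node : Tree → Tree → Tree

size : Tree → ℕ
size leaf       = 0
size (node l r) = suc (size l + size r)

LeftRow : ℕ → Tree → Set
LeftRow m       leaf       = ⊥
LeftRow zero    (node l r) = ⊤
LeftRow (suc m) (node l r) = LeftRow m l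

TreeCond : ℕ → Tree → Set
TreeCond k leaf       = ⊥
TreeCond k (node l r) = LeftRow (k ∸ 1) (node l r) × RightCond r
  where
  RightCond : Tree → Set
  RightCond leaf         = ⊥
  RightCond (node l' r') = LeftRow k (node l' r')

SpecialTrees : ℕ → ℕ → Set
SpecialTrees k n = Σ Tree λ t → size t ≡ n + k × TreeCond k t

-- Order the cars so that the preferences descend, a₁ ≥ ⋯ ≥ aₙ. Under the j-Naples rule car i can only end
-- up in the window (aᵢ − j − 1, n] of spots, these windows grow with i, and every earlier car sits in the window
-- of car i; so car i parks unless the i − 1 parked cars fill its window, and counting shows that it parks iff
-- aᵢ ≤ (n − i + 1) + j. Appending k ones turns these bounds for j = k into the ballot condition "every entry is
-- at most the number of entries from it on" for a descending sequence of length n + k, and strictness becomes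
-- the failure of that condition once one of the ones is dropped. Ballot sequences of length m encode binary
-- trees of size m: the first entry equal to the number of entries from it on belongs to the root and separates
-- the codes of the two subtrees. In this code a₁ ≤ n says that the root has k left children in a row, the k
-- trailing ones say that the rightmost node has k − 1 of them, and strictness says that the root has a right
-- child. Reversing all right spines moves the row at the rightmost node to the root, and a rotation turns these
-- trees into those of the statement.

module Submission where

open import Defs
open import Data.Nat using (ℕ; _≤_)
open import Function.Bundles using (_↔_)

open import Data.Bool using (true; false; T; not)
open import Data.Bool.Properties using (T-≡; T-∧; T-irrelevant)
open import Data.Empty using (⊥; ⊥-elim)
open import Data.List using (List; []; _∷_; _++_; _∷ʳ_; map; length; replicate; take; upTo; applyUpTo)
open import Data.List.Properties
  using (length-applyUpTo; length-++; length-replicate; length-map; ∷-injectiveˡ; ∷-injectiveʳ; ∷ʳ-injectiveˡ;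
         ++-assoc; ++-identityʳ; map-cong; map-id)
open import Data.List.Membership.Propositional using (_∈_; _∉_)
open import Data.List.Membership.Propositional.Properties
  using (∈-++⁺ˡ; ∈-++⁺ʳ; ∈-++⁻; ∈-∃++; ∈-map⁻; ∈-map⁺; ∈-map∘filter⁻; ∈-map∘filter⁺; ∈-upTo⁺; ∈-upTo⁻;
         ∈-applyUpTo⁺; ∈-applyUpTo⁻)
open import Data.List.Relation.Binary.Subset.Propositional using (_⊆_)
open import Data.List.Relation.Unary.All as All using (All; []; _∷_)
open import Data.List.Relation.Unary.All.Properties using (¬Any⇒All¬; replicate⁺)
open import Data.List.Relation.Unary.Any as Any using (here; there)
open import Data.List.Relation.Unary.Any.Properties using (any⁺; any⁻)
open import Data.List.Relation.Unary.Linked as Linked using (Linked; []; [-]; _∷_)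
open import Data.List.Relation.Unary.Linked.Properties using (Linked⇒All)
open import Data.List.Relation.Unary.Unique.Propositional using (Unique; []; _∷_)
open import Data.List.Relation.Unary.Unique.Propositional.Properties using (applyUpTo⁺₁)
open import Data.Maybe using (just; nothing; is-just)
open import Data.Nat
open import Data.Nat.Properties
open import Data.Nat.Tactic.RingSolver using (solve-∀)
open import Data.List.Membership.DecPropositional _≟_ using (_∈?_)
open import Data.Product as Product using (Σ; ∃-syntax; ∃₂; _×_; _,_; proj₁; proj₂)
open import Data.Sum using (inj₁; inj₂)
open import Data.Unit using (⊤; tt)
open import Data.Vec using (Vec; []; _∷_; toList)
open import Data.Vec.Properties using (length-toList)
import Data.Vec.Relation.Unary.All as VecAll
import Data.Vec.Relation.Unary.All.Properties as VecAll
open import Function using (id; _∘_; _⇔_; mk⇔; Equivalence; mk↔ₛ′)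
open import Function.Construct.Composition using (_⇔-∘_)
open import Function.Construct.Symmetry using (⇔-sym)
open import Relation.Binary.Definitions using (tri<; tri≈; tri>)
open import Relation.Binary.PropositionalEquality
open import Relation.Nullary using (¬_; yes; no; contradiction; Irrelevant)
open import Relation.Nullary.Decidable using (T?)
import Relation.Unary as U

×-irrelevant : ∀ {A B : Set} → Irrelevant A → Irrelevant B → Irrelevant (A × B)
×-irrelevant A-irrelevant B-irrelevant (a , b) (a′ , b′) = cong₂ _,_ (A-irrelevant a a′) (B-irrelevant b b′)

record SubsetInverse {A B : Set} (P : A → Set) (Q : B → Set) : Set where
  field
    to        : A → B
    from      : B → A
    to-pres   : ∀ {a} → P a → Q (to a)
    from-pres : ∀ {b} → Q b → P (from b)
    to-from   : ∀ {b} → Q b → to (from b) ≡ b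
    from-to   : ∀ {a} → P a → from (to a) ≡ a

infixr 9 _⨾_

_⨾_ : ∀ {A B C : Set} {P : A → Set} {Q : B → Set} {R : C → Set} → SubsetInverse P Q → SubsetInverse Q R → SubsetInverse P R
f ⨾ g = record
  { to        = G.to ∘ F.to
  ; from      = F.from ∘ G.from
  ; to-pres   = G.to-pres ∘ F.to-pres
  ; from-pres = F.from-pres ∘ G.from-pres
  ; to-from   = λ r → trans (cong G.to (F.to-from (G.from-pres r))) (G.to-from r)
  ; from-to   = λ p → trans (cong F.from (G.from-to (F.to-pres p))) (F.from-to p)
  }
  where
  module F = SubsetInverse f
  module G = SubsetInverse g

⇔⇒SubsetInverse : ∀ {A : Set} {P Q : A → Set} → (∀ {a} → P a ⇔ Q a) → SubsetInverse P Q
⇔⇒SubsetInverse P⇔Q = record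
  { to = id ; from = id ; to-pres = Equivalence.to P⇔Q ; from-pres = Equivalence.from P⇔Q ; to-from = λ _ → refl ; from-to = λ _ → refl }

SubsetInverse⇒↔ : ∀ {A B : Set} {P : A → Set} {Q : B → Set} → U.Irrelevant P → U.Irrelevant Q → SubsetInverse P Q → Σ A P ↔ Σ B Q
SubsetInverse⇒↔ {P = P} {Q} P-irrelevant Q-irrelevant f = mk↔ₛ′
  (λ (a , p) → to a , to-pres p) (λ (b , q) → from b , from-pres q)
  (λ (b , q) → Σ-≡ Q-irrelevant (to-from q)) (λ (a , p) → Σ-≡ P-irrelevant (from-to p))
  where
  open SubsetInverse f
  Σ-≡ : ∀ {A : Set} {R : A → Set} → U.Irrelevant R → ∀ {a a′} {r : R a} {r′ : R a′} → a ≡ a′ → (a , r) ≡ (a′ , r′)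
  Σ-≡ R-irrelevant refl = cong (_ ,_) (R-irrelevant _ _)

m∸[1+n]<o⇔ : ∀ m n o → m ∸ suc n < o ⇔ (1 ≤ o × m ≤ o + n)
m∸[1+n]<o⇔ m n o = mk⇔ to from
  where
  to : m ∸ suc n < o → 1 ≤ o × m ≤ o + n
  to (s≤s {n = o′} m∸[1+n]≤o′) = s≤s z≤n , (begin
    m                     ≤⟨ m≤n+m∸n m (suc n) ⟩
    suc n + (m ∸ suc n)   ≤⟨ +-monoʳ-≤ (suc n) m∸[1+n]≤o′ ⟩
    suc n + o′            ≡⟨ cong suc (+-comm n o′) ⟩
    suc o′ + n            ∎)
    where open ≤-Reasoning
  from : 1 ≤ o × m ≤ o + n → m ∸ suc n < o
  from (s≤s {n = o′} _ , m≤o+n) = s≤s (m≤n+o⇒m∸n≤o m (suc n) (≤-trans m≤o+n (≤-reflexive (cong suc (+-comm o′ n)))))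

m≤1+n⇒m+o≤n+1+o : ∀ {m n} o → m ≤ suc n → m + o ≤ n + suc o
m≤1+n⇒m+o≤n+1+o {n = n} o m≤1+n = ≤-trans (+-monoˡ-≤ o m≤1+n) (≤-reflexive (sym (+-suc n o)))

[m+n]+1+o≡[m+o]+1+n : ∀ m n o → m + n + suc o ≡ m + o + suc n
[m+n]+1+o≡[m+o]+1+n = solve-∀

m+1+[n+o]≡n+1+[m+o] : ∀ m n o → m + suc (n + o) ≡ n + suc (m + o)
m+1+[n+o]≡n+1+[m+o] = solve-∀

T-not⇔¬T : ∀ {b} → T (not b) ⇔ (¬ T b)
T-not⇔¬T {false} = mk⇔ (λ _ ()) _
T-not⇔¬T {true}  = mk⇔ (λ ()) (λ ¬T → ¬T tt)

Unique-⊆⇒length≤ : ∀ {A : Set} {xs ys : List A} → Unique xs → xs ⊆ ys → length xs ≤ length ys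
Unique-⊆⇒length≤ {xs = []} _ _ = z≤n
Unique-⊆⇒length≤ {xs = x ∷ xs} (x∉xs ∷ u) xs⊆ys with ys₁ , ys₂ , refl ← ∈-∃++ (xs⊆ys (here refl)) =
  begin
    suc (length xs)                ≤⟨ s≤s (Unique-⊆⇒length≤ u xs⊆ys₁++ys₂) ⟩
    suc (length (ys₁ ++ ys₂))      ≡⟨ cong suc (length-++ ys₁) ⟩
    suc (length ys₁ + length ys₂)  ≡⟨ +-suc (length ys₁) _ ⟨
    length ys₁ + length (x ∷ ys₂)  ≡⟨ length-++ ys₁ ⟨
    length (ys₁ ++ x ∷ ys₂)        ∎
  where
  open ≤-Reasoning
  xs⊆ys₁++ys₂ : xs ⊆ ys₁ ++ ys₂
  xs⊆ys₁++ys₂ y∈xs with ∈-++⁻ ys₁ (xs⊆ys (there y∈xs))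
  ... | inj₁ y∈ys₁         = ∈-++⁺ˡ y∈ys₁
  ... | inj₂ (here refl)   = contradiction refl (All.lookup x∉xs y∈xs)
  ... | inj₂ (there y∈ys₂) = ∈-++⁺ʳ ys₁ y∈ys₂

take-++-length : {A : Set} (Y : List A) {Z : List A} → take (length Y) (Y ++ Z) ≡ Y
take-++-length []      = refl
take-++-length (y ∷ Y) = cong (y ∷_) (take-++-length Y)

replicate-∷ʳ : {A : Set} (m : ℕ) (x : A) → replicate m x ∷ʳ x ≡ replicate (suc m) x
replicate-∷ʳ zero    x = refl
replicate-∷ʳ (suc m) x = cong (x ∷_) (replicate-∷ʳ m x)

map-+-∸ : ∀ m xs → map (_∸ m) (map (_+ m) xs) ≡ xs
map-+-∸ m []       = refl
map-+-∸ m (x ∷ xs) = cong₂ _∷_ (m+n∸n≡m x m) (map-+-∸ m xs)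

-- pads with zeros or truncates; only used on lists of length n
toVec : ∀ n → List ℕ → Vec ℕ n
toVec zero    _        = []
toVec (suc n) []       = 0 ∷ toVec n []
toVec (suc n) (x ∷ xs) = x ∷ toVec n xs

toList-toVec : ∀ {n} l → length l ≡ n → toList (toVec n l) ≡ l
toList-toVec []      refl = refl
toList-toVec (x ∷ l) refl = cong (x ∷_) (toList-toVec l refl)

toVec-toList : ∀ {n} (a : Vec ℕ n) → toVec n (toList a) ≡ a
toVec-toList []      = refl
toVec-toList (x ∷ a) = cong (x ∷_) (toVec-toList a)

-- Parking a weakly decreasing preference list

∈⇒occupied : ∀ {occ s} → s ∈ occ → T (occupied occ s)
∈⇒occupied {s = s} = any⁺ _ ∘ Any.map (λ { refl → ≡⇒≡ᵇ s s refl })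

occupied⇒∈ : ∀ {occ s} → T (occupied occ s) → s ∈ occ
occupied⇒∈ {occ} = Any.map (λ s≡ᵇ → sym (≡ᵇ⇒≡ _ _ s≡ᵇ)) ∘ any⁻ _ occ

firstFree-just : ∀ occ L {s} → firstFree occ L ≡ just s → s ∈ L × s ∉ occ
firstFree-just occ (y ∷ L) eq with occupied occ y in occ-y
firstFree-just occ (y ∷ L) eq | true with s∈L , s∉occ ← firstFree-just occ L eq = there s∈L , s∉occ
firstFree-just occ (y ∷ L) refl | false = here refl , λ y∈occ → subst T occ-y (∈⇒occupied y∈occ)

firstFree-nothing : ∀ occ L → firstFree occ L ≡ nothing → L ⊆ occ
firstFree-nothing occ (y ∷ L) eq with occupied occ y in occ-y
firstFree-nothing occ (y ∷ L) eq | true = λ where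
  (here refl)  → occupied⇒∈ (Equivalence.from T-≡ occ-y)
  (there t∈L) → firstFree-nothing occ L eq t∈L
firstFree-nothing occ (y ∷ L) () | false

⊆⇒firstFree≡nothing : ∀ occ L → L ⊆ occ → firstFree occ L ≡ nothing
⊆⇒firstFree≡nothing occ []      _    = refl
⊆⇒firstFree≡nothing occ (y ∷ L) L⊆occ
  rewrite Equivalence.to T-≡ (∈⇒occupied (L⊆occ (here refl))) = ⊆⇒firstFree≡nothing occ L (L⊆occ ∘ there)

-- the spots where a car preferring x can park under the j-Naples rule
InWindow : ℕ → ℕ → ℕ → ℕ → Set
InWindow j n x t = 1 ≤ t × t ≤ n × x ≤ t + j

-- the window is the interval (d, n] with d = x ∸ (1 + j)
window : ℕ → ℕ → ℕ → List ℕ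
window j n x = applyUpTo (λ i → suc (x ∸ suc j + i)) (n ∸ (x ∸ suc j))

module _ {j n x : ℕ} (x≤n : x ≤ n) where

  private
    d = x ∸ suc j
    d≤n : d ≤ n
    d≤n = ≤-trans (m∸n≤m x (suc j)) x≤n

  window⇒InWindow : ∀ {t} → t ∈ window j n x → InWindow j n x t
  window⇒InWindow t∈ with i , i<n∸d , refl ← ∈-applyUpTo⁻ _ t∈
    with 1≤t , x≤t+j ← Equivalence.to (m∸[1+n]<o⇔ x j _) (s≤s (m≤m+n d i)) =
    1≤t , ≤-trans (≤-reflexive (sym (+-suc d i))) (≤-trans (+-monoʳ-≤ d i<n∸d) (≤-reflexive (m+[n∸m]≡n d≤n))) , x≤t+j

  InWindow⇒window : ∀ {t} → InWindow j n x t → t ∈ window j n x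
  InWindow⇒window {t} (1≤t , t≤n , x≤t+j) =
    subst (_∈ window j n x) d+i≡t (∈-applyUpTo⁺ _ (m+n≤o⇒m≤o∸n (suc i) (≤-trans (≤-reflexive (trans (cong suc (+-comm i d)) d+i≡t)) t≤n)))
    where
    d<t : d < t
    d<t = Equivalence.from (m∸[1+n]<o⇔ x j t) (1≤t , x≤t+j)
    i = t ∸ suc d
    d+i≡t : suc (d + i) ≡ t
    d+i≡t = m+[n∸m]≡n d<t

  length-window : length (window j n x) ≡ n ∸ d
  length-window = length-applyUpTo _ (n ∸ d)

unique-window : ∀ j n x → Unique (window j n x)
unique-window j n x = applyUpTo⁺₁ _ _ (λ i<k _ eq → <⇒≢ i<k (+-cancelˡ-≡ (x ∸ suc j) _ _ (suc-injective eq)))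

module _ {j n x : ℕ} where

  backSpots⇒InWindow : x ≤ n → ∀ {t} → t ∈ backSpots j x → InWindow j n x t
  backSpots⇒InWindow x≤n t∈ with i , i∈ , refl , 1+i<ᵇx ← ∈-map∘filter⁻ (λ i → x ∸ suc i) (T? ∘ λ i → suc i <ᵇ x) {xs = upTo j} t∈ =
    m<n⇒0<n∸m 1+i<x , ≤-trans (m∸n≤m x (suc i)) x≤n , (begin
      x                      ≡⟨ m∸n+n≡m (<⇒≤ 1+i<x) ⟨
      (x ∸ suc i) + suc i    ≤⟨ +-monoʳ-≤ (x ∸ suc i) (∈-upTo⁻ i∈) ⟩
      (x ∸ suc i) + j        ∎)
    where
    open ≤-Reasoning
    1+i<x = <ᵇ⇒< (suc i) x 1+i<ᵇx

  InWindow⇒backSpots : ∀ {t} → InWindow j n x t → t < x → t ∈ backSpots j x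
  InWindow⇒backSpots {t} (1≤t , _ , x≤t+j) t<x =
    ∈-map∘filter⁺ (λ i → x ∸ suc i) (T? ∘ λ i → suc i <ᵇ x) {xs = upTo j} (i , ∈-upTo⁺ i<j , sym x∸[1+i]≡t , <⇒<ᵇ 1+i<x)
    where
    i = x ∸ suc t
    1+i≡x∸t : suc i ≡ x ∸ t
    1+i≡x∸t = sym (+-∸-assoc 1 t<x)
    i<j : i < j
    i<j = subst (i <_) (m+n∸m≡n (suc t) j) (∸-monoˡ-< {x} {suc t} {suc t + j} (s≤s x≤t+j) t<x)
    1+i<x : suc i < x
    1+i<x = subst (_< x) (sym 1+i≡x∸t) (∸-monoʳ-< {x} {t} {0} 1≤t (<⇒≤ t<x))
    x∸[1+i]≡t : x ∸ suc i ≡ t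
    x∸[1+i]≡t = trans (cong (x ∸_) 1+i≡x∸t) (m∸[m∸n]≡n (<⇒≤ t<x))

  forwardSpots⇒InWindow : 1 ≤ x → x ≤ n → ∀ {t} → t ∈ forwardSpots n x → InWindow j n x t
  forwardSpots⇒InWindow 1≤x x≤n t∈ with i , i∈ , refl ← ∈-map⁻ (λ i → x + suc i) t∈ =
    ≤-trans 1≤x x≤t , ≤-trans (+-monoʳ-≤ x (∈-upTo⁻ i∈)) (≤-reflexive (m+[n∸m]≡n x≤n)) , ≤-trans x≤t (m≤m+n _ j)
    where
    x≤t : x ≤ x + suc i
    x≤t = m≤m+n x (suc i)

  InWindow⇒forwardSpots : ∀ {t} → InWindow j n x t → x < t → t ∈ forwardSpots n x
  InWindow⇒forwardSpots {t} (_ , t≤n , _) x<t =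
    subst (_∈ forwardSpots n x) x+[1+i]≡t (∈-map⁺ (λ i → x + suc i) (∈-upTo⁺ (∸-monoˡ-< {t} {suc x} {suc n} (s≤s t≤n) x<t)))
    where
    x+[1+i]≡t : x + suc (t ∸ suc x) ≡ t
    x+[1+i]≡t = trans (+-suc x _) (m+[n∸m]≡n x<t)

module _ {j n x : ℕ} (1≤x : 1 ≤ x) (x≤n : x ≤ n) where

  searchSpots⇒window : backSpots j x ++ forwardSpots n x ⊆ window j n x
  searchSpots⇒window t∈ with ∈-++⁻ (backSpots j x) t∈
  ... | inj₁ t∈back = InWindow⇒window x≤n (backSpots⇒InWindow x≤n t∈back)
  ... | inj₂ t∈fwd  = InWindow⇒window x≤n (forwardSpots⇒InWindow 1≤x x≤n t∈fwd)

  window⇒searchSpots : ∀ {t} → t ∈ window j n x → t ≢ x → t ∈ backSpots j x ++ forwardSpots n x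
  window⇒searchSpots {t} t∈W t≢x with <-cmp t x
  ... | tri< t<x _ _ = ∈-++⁺ˡ (InWindow⇒backSpots (window⇒InWindow x≤n t∈W) t<x)
  ... | tri≈ _ t≡x _ = contradiction t≡x t≢x
  ... | tri> _ _ x<t = ∈-++⁺ʳ (backSpots j x) (InWindow⇒forwardSpots (window⇒InWindow x≤n t∈W) x<t)

  x∈window : x ∈ window j n x
  x∈window = InWindow⇒window x≤n (1≤x , x≤n , m≤m+n x j)

window-anti : ∀ {j n x y} → y ≤ x → x ≤ n → window j n x ⊆ window j n y
window-anti y≤x x≤n t∈ with 1≤t , t≤n , x≤t+j ← window⇒InWindow x≤n t∈ =
  InWindow⇒window (≤-trans y≤x x≤n) (1≤t , t≤n , ≤-trans y≤x x≤t+j)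

-- a car preferring x arrives with the spots occ taken and r more cars to come
module _ {j n : ℕ} {occ : List ℕ} {x r : ℕ} (occ-unique : Unique occ) (occ⊆W : occ ⊆ window j n x)
         (count : length occ + suc r ≡ n) (1≤x : 1 ≤ x) (x≤n : x ≤ n) where

  private
    c = length occ
    n∸r≡c : n ∸ suc r ≡ c
    n∸r≡c = trans (cong (_∸ suc r) (sym count)) (m+n∸n≡m c (suc r))

  fits⇔room : x ≤ suc r + j ⇔ c < length (window j n x)
  fits⇔room = mk⇔
    (λ x≤r+j → subst₂ _<_ n∸r≡c (sym (length-window x≤n))
                 (∸-monoʳ-< (Equivalence.from (m∸[1+n]<o⇔ x j (suc r)) (s≤s z≤n , x≤r+j)) (subst (suc r ≤_) count (m≤n+m (suc r) c))))
    (λ c<W → proj₂ (Equivalence.to (m∸[1+n]<o⇔ x j (suc r))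
                 (∸-cancelʳ-< (subst₂ _<_ (sym n∸r≡c) (length-window x≤n) c<W))))

  park-succeeds : x ≤ suc r + j → ∃[ s ] parkCar j n occ x ≡ just s × s ∉ occ × s ∈ window j n x
  park-succeeds x≤r+j with occupied occ x in occ-x
  ... | false = x , refl , (λ x∈occ → subst T occ-x (∈⇒occupied x∈occ)) , x∈window 1≤x x≤n
  ... | true with firstFree occ (backSpots j x ++ forwardSpots n x) in found
  ...   | just s with s∈search , s∉occ ← firstFree-just occ _ found =
    s , refl , s∉occ , searchSpots⇒window 1≤x x≤n s∈search
  ...   | nothing = contradiction (Unique-⊆⇒length≤ (unique-window j n x) W⊆occ)
                      (<⇒≱ (Equivalence.to fits⇔room x≤r+j))
    where
    W⊆occ : window j n x ⊆ occ
    W⊆occ {t} t∈W with t ≟ x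
    ... | yes refl = occupied⇒∈ (Equivalence.from T-≡ occ-x)
    ... | no t≢x   = firstFree-nothing occ _ found (window⇒searchSpots 1≤x x≤n t∈W t≢x)

  window-full : ¬ (x ≤ suc r + j) → window j n x ⊆ occ
  window-full x≰r+j {t} t∈W with t ∈? occ
  ... | yes t∈occ = t∈occ
  ... | no  t∉occ = contradiction (Equivalence.from fits⇔room (Unique-⊆⇒length≤ (¬Any⇒All¬ occ t∉occ ∷ occ-unique) t∷occ⊆W))
                                  x≰r+j
    where
    t∷occ⊆W : t ∷ occ ⊆ window j n x
    t∷occ⊆W (here refl)   = t∈W
    t∷occ⊆W (there t∈occ) = occ⊆W t∈occ

  park-fails : ¬ (x ≤ suc r + j) → parkCar j n occ x ≡ nothing
  park-fails x≰r+j rewrite Equivalence.to T-≡ (∈⇒occupied (window-full x≰r+j (x∈window 1≤x x≤n))) =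
    ⊆⇒firstFree≡nothing occ _ (window-full x≰r+j ∘ searchSpots⇒window 1≤x x≤n)

Fits : ℕ → List ℕ → Set
Fits j []       = ⊤
Fits j (x ∷ xs) = x ≤ suc (length xs) + j × Fits j xs

module _ {j n : ℕ} where

  InNextWindow : List ℕ → List ℕ → Set
  InNextWindow occ []      = ⊤
  InNextWindow occ (x ∷ _) = occ ⊆ window j n x

  runNaples⇔Fits : ∀ occ xs → Unique occ → length occ + length xs ≡ n →
                   All (λ x → 1 ≤ x × x ≤ n) xs → Linked _≥_ xs → InNextWindow occ xs →
                   T (is-just (runNaples j n occ xs)) ⇔ Fits j xs
  runNaples⇔Fits occ [] _ _ _ _ _ = mk⇔ _ _
  runNaples⇔Fits occ (x ∷ xs) occ-unique count ((1≤x , x≤n) ∷ in-range) descending occ⊆W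
    with x ≤? suc (length xs) + j
  ... | no x≰ rewrite park-fails occ-unique occ⊆W count 1≤x x≤n x≰ = mk⇔ (λ ()) (x≰ ∘ proj₁)
  ... | yes x≤ with s , parked , s∉occ , s∈W ← park-succeeds occ-unique occ⊆W count 1≤x x≤n x≤
    rewrite parked = mk⇔ (λ parks → x≤ , Equivalence.to rest parks) (Equivalence.from rest ∘ proj₂)
    where
    s∷occ⊆W : s ∷ occ ⊆ window j n x
    s∷occ⊆W (here refl)   = s∈W
    s∷occ⊆W (there t∈occ) = occ⊆W t∈occ
    next : ∀ xs → Linked _≥_ (x ∷ xs) → InNextWindow (s ∷ occ) xs
    next []      _         = tt
    next (y ∷ _) (y≤x ∷ _) = window-anti y≤x x≤n ∘ s∷occ⊆W
    rest = runNaples⇔Fits (s ∷ occ) xs (¬Any⇒All¬ occ s∉occ ∷ occ-unique) (trans (sym (+-suc _ _)) count)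
                          in-range (Linked.tail descending) (next xs descending)

isNaples⇔Fits : ∀ {j n} as → length as ≡ n → All (λ x → 1 ≤ x × x ≤ n) as → Linked _≥_ as →
                T (isNaples j n as) ⇔ Fits j as
isNaples⇔Fits {j} {n} as count in-range descending =
  runNaples⇔Fits [] as [] count in-range descending (nothing-occupied as)
  where
  nothing-occupied : ∀ as → InNextWindow {j} {n} [] as
  nothing-occupied []      = tt
  nothing-occupied (_ ∷ _) = λ ()

-- Ballot sequences

HeadAtMost : ℕ → List ℕ → Set
HeadAtMost x []      = ⊤
HeadAtMost x (y ∷ _) = y ≤ x

Ballot : List ℕ → Set
Ballot []       = ⊤
Ballot (x ∷ xs) = 1 ≤ x × x ≤ suc (length xs) × HeadAtMost x xs × Ballot xs

Ballot-++⁻ʳ : ∀ xs {ys} → Ballot (xs ++ ys) → Ballot ys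
Ballot-++⁻ʳ []       ballot             = ballot
Ballot-++⁻ʳ (x ∷ xs) (_ , _ , _ , ballot) = Ballot-++⁻ʳ xs ballot

ones : ℕ → List ℕ
ones k = replicate k 1

Ballot-ones : ∀ k → Ballot (ones k)
Ballot-ones zero          = tt
Ballot-ones (suc zero)    = ≤-refl , ≤-refl , tt , tt
Ballot-ones (suc (suc k)) = ≤-refl , s≤s z≤n , ≤-refl , Ballot-ones (suc k)

length-++-ones : ∀ l k → length (l ++ ones k) ≡ length l + k
length-++-ones l k = trans (length-++ l) (cong (length l +_) (length-replicate k))

Ballot-++-ones : ∀ k l → Ballot (l ++ ones k) ⇔ (All (1 ≤_) l × Linked _≥_ l × Fits k l)
Ballot-++-ones k []      = mk⇔ (λ _ → [] , [] , tt) (λ _ → Ballot-ones k)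
Ballot-++-ones k (x ∷ l) = mk⇔
  (λ (1≤x , x≤ , head≤x , ballot) → let (positive , descending , fits) = Equivalence.to (Ballot-++-ones k l) ballot in
     1≤x ∷ positive , linked l head≤x descending , subst (x ≤_) (cong suc (length-++-ones l k)) x≤ , fits)
  (λ where (1≤x ∷ positive , descending , x≤ , fits) →
             1≤x , subst (x ≤_) (sym (cong suc (length-++-ones l k))) x≤ , head≤x l 1≤x descending ,
             Equivalence.from (Ballot-++-ones k l) (positive , Linked.tail descending , fits))
  where
  linked : ∀ l → HeadAtMost x (l ++ ones k) → Linked _≥_ l → Linked _≥_ (x ∷ l)
  linked []      _    _          = [-]
  linked (y ∷ _) y≤x descending = y≤x ∷ descending
  head≤x : ∀ l → 1 ≤ x → Linked _≥_ (x ∷ l) → HeadAtMost x (l ++ ones k)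
  head≤x []      1≤x _           = ones-head≤ k
    where
    ones-head≤ : ∀ k → HeadAtMost x (ones k)
    ones-head≤ zero    = tt
    ones-head≤ (suc k) = 1≤x
  head≤x (y ∷ _) _   (y≤x ∷ _)   = y≤x

HeadBound : ℕ → List ℕ → Set
HeadBound m []       = ⊥
HeadBound m (y ∷ ys) = y + m ≤ suc (length ys)

HeadBound-++-ones : ∀ k x l → HeadBound k (x ∷ l ++ ones k) ⇔ x ≤ suc (length l)
HeadBound-++-ones k x l = mk⇔
  (λ bound → +-cancelʳ-≤ k x (suc (length l)) (subst (x + k ≤_) (cong suc (length-++-ones l k)) bound))
  (λ x≤ → subst (x + k ≤_) (sym (cong suc (length-++-ones l k))) (+-monoˡ-≤ k x≤))

++-ones-∷ʳ : ∀ Y j → (Y ++ ones j) ∷ʳ 1 ≡ Y ++ ones (suc j)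
++-ones-∷ʳ Y j = trans (++-assoc Y (ones j) (1 ∷ [])) (cong (Y ++_) (replicate-∷ʳ j 1))

∈-ones : ∀ Z {b E} j → Z ++ b ∷ E ≡ ones j → b ≡ 1
∈-ones Z j eq = All.lookup (subst (All (_≡ 1)) (sym eq) (replicate⁺ j refl)) (∈-++⁺ʳ Z (here refl))

ones-suffix : ∀ Z {b E} Y {j} → Z ++ b ∷ E ≡ Y ++ ones j → b ≢ 1 → ∃[ Y′ ] E ≡ Y′ ++ ones j
ones-suffix []      []      {j}  eq b≢1 = contradiction (∈-ones [] j eq) b≢1
ones-suffix []      (y ∷ Y)      eq _   = Y , ∷-injectiveʳ eq
ones-suffix (z ∷ Z) []      {j}  eq b≢1 = contradiction (∈-ones (z ∷ Z) j eq) b≢1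
ones-suffix (z ∷ Z) (y ∷ Y)      eq b≢1 = ones-suffix Z Y (∷-injectiveʳ eq) b≢1

-- Encoding binary trees by ballot sequences

join : ℕ → List ℕ → List ℕ → List ℕ
join m L R = map (_+ m) L ++ suc m ∷ R

encode : Tree → List ℕ
encode leaf       = []
encode (node l r) = join (size r) (encode l) (encode r)

length-join : ∀ m L R → length (join m L R) ≡ length L + suc (length R)
length-join m L R = trans (length-++ (map (_+ m) L)) (cong (_+ suc (length R)) (length-map (_+ m) L))

length-encode : ∀ t → length (encode t) ≡ size t
length-encode leaf       = refl
length-encode (node l r) = begin
  length (join (size r) (encode l) (encode r))   ≡⟨ length-join (size r) (encode l) (encode r) ⟩
  length (encode l) + suc (length (encode r))    ≡⟨ cong₂ (λ a b → a + suc b) (length-encode l) (length-encode r) ⟩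
  size l + suc (size r)                          ≡⟨ +-suc (size l) (size r) ⟩
  suc (size l + size r)                          ∎
  where open ≡-Reasoning

Ballot-join : ∀ {m} L {R} → Ballot L → Ballot R → length R ≡ m → Ballot (join m L R)
Ballot-join [] {R} _ ballotR refl = s≤s z≤n , ≤-refl , head≤ R ballotR , ballotR
  where
  head≤ : ∀ R → Ballot R → HeadAtMost (suc (length R)) R
  head≤ []      _               = tt
  head≤ (y ∷ _) (_ , y≤ , _ , _) = m≤n⇒m≤1+n y≤
Ballot-join {m} (y ∷ L) {R} (1≤y , y≤ , head≤y , ballotL) ballotR refl =
  ≤-trans 1≤y (m≤m+n y m) ,
  subst (y + m ≤_) (cong suc (sym (length-join m L R))) (m≤n⇒m≤1+n (m≤1+n⇒m+o≤n+1+o m y≤)) ,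
  head≤ L head≤y ,
  Ballot-join L ballotL ballotR refl
  where
  head≤ : ∀ L → HeadAtMost y L → HeadAtMost (y + m) (join m L R)
  head≤ []      _   = +-monoˡ-≤ m 1≤y
  head≤ (z ∷ _) z≤y = +-monoˡ-≤ m z≤y

Ballot-encode : ∀ t → Ballot (encode t)
Ballot-encode leaf       = tt
Ballot-encode (node l r) = Ballot-join (encode l) (Ballot-encode l) (Ballot-encode r) (length-encode r)

-- in encode (node l r) the first entry equal to the number of entries from it on is the root's
splitRoot : List ℕ → List ℕ × List ℕ
splitRoot []       = [] , []
splitRoot (x ∷ xs) with x ≟ suc (length xs)
... | yes _ = [] , x ∷ xs
... | no  _ = Product.map₁ (x ∷_) (splitRoot xs)

mutual
  decodeWith : ℕ → List ℕ → Tree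
  decodeWith zero    _  = leaf
  decodeWith (suc f) xs = decodeSplit f (splitRoot xs)

  decodeSplit : ℕ → List ℕ × List ℕ → Tree
  decodeSplit f (L , [])    = leaf
  decodeSplit f (L , _ ∷ R) = node (decodeWith f (map (_∸ length R) L)) (decodeWith f R)

decode : List ℕ → Tree
decode xs = decodeWith (length xs) xs

splitRoot-join : ∀ {m} L {R} → Ballot L → length R ≡ m → splitRoot (join m L R) ≡ (map (_+ m) L , suc m ∷ R)
splitRoot-join [] {R} _ refl with suc (length R) ≟ suc (length R)
... | yes _  = refl
... | no  ≢ = contradiction refl ≢
splitRoot-join {m} (y ∷ L) {R} (_ , y≤ , _ , ballotL) refl with y + m ≟ suc (length (join m L R))
... | yes eq = contradiction (m≤1+n⇒m+o≤n+1+o m y≤) (<⇒≱ (≤-reflexive (trans (cong suc (sym (length-join m L R))) (sym eq))))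
... | no  _  = cong (Product.map₁ (y + m ∷_)) (splitRoot-join L ballotL refl)

decodeWith-encode : ∀ f t → size t ≤ f → decodeWith f (encode t) ≡ t
decodeWith-encode zero    leaf       _   = refl
decodeWith-encode (suc f) leaf       _   = refl
decodeWith-encode (suc f) (node l r) (s≤s size≤f) = begin
  decodeSplit f (splitRoot (encode (node l r)))
    ≡⟨ cong (decodeSplit f) (splitRoot-join (encode l) (Ballot-encode l) (length-encode r)) ⟩
  node (decodeWith f (map (_∸ length (encode r)) (map (_+ size r) (encode l)))) (decodeWith f (encode r))
    ≡⟨ cong (λ m → node (decodeWith f (map (_∸ m) (map (_+ size r) (encode l)))) (decodeWith f (encode r))) (length-encode r) ⟩
  node (decodeWith f (map (_∸ size r) (map (_+ size r) (encode l)))) (decodeWith f (encode r))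
    ≡⟨ cong (λ xs → node (decodeWith f xs) (decodeWith f (encode r))) (map-+-∸ (size r) (encode l)) ⟩
  node (decodeWith f (encode l)) (decodeWith f (encode r))
    ≡⟨ cong₂ node (decodeWith-encode f l (≤-trans (m≤m+n (size l) (size r)) size≤f))
                  (decodeWith-encode f r (≤-trans (m≤n+m (size r) (size l)) size≤f)) ⟩
  node l r ∎
  where open ≡-Reasoning

decode-encode : ∀ t → decode (encode t) ≡ t
decode-encode t = decodeWith-encode (length (encode t)) t (≤-reflexive (sym (length-encode t)))

join-head : ∀ {m} L {R y ys} → Ballot L → y ∷ ys ≡ join m L R → suc m ≤ y
join-head     []      _            refl = ≤-refl
join-head {m} (z ∷ L) (1≤z , _)    refl = +-monoˡ-≤ m 1≤z

Ballot-decompose : ∀ {x xs} → Ballot (x ∷ xs) → ∃₂ λ L R → Ballot L × Ballot R × x ∷ xs ≡ join (length R) L R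
Ballot-decompose {x} {xs} (1≤x , x≤ , head≤x , ballot) with x ≟ suc (length xs)
... | yes refl = [] , xs , tt , ballot , refl
... | no  x≢   = extend xs (≤∧≢⇒< x≤ x≢) head≤x ballot
  where
  extend : ∀ xs → x < suc (length xs) → HeadAtMost x xs → Ballot xs →
           ∃₂ λ L R → Ballot L × Ballot R × x ∷ xs ≡ join (length R) L R
  extend []       (s≤s x≤0) _   _      = contradiction x≤0 (<⇒≱ 1≤x)
  extend (y ∷ ys) (s≤s x≤len) y≤x ballot with L , R , ballotL , ballotR , eq ← Ballot-decompose ballot =
    (x ∸ m) ∷ L , R , (m<n⇒0<n∸m m<x , x∸m≤ , head≤ L eq , ballotL) , ballotR , cong₂ _∷_ (sym (m∸n+n≡m (<⇒≤ m<x))) eq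
    where
    m = length R
    m<x : m < x
    m<x = ≤-trans (join-head L ballotL eq) y≤x
    x∸m≤ : x ∸ m ≤ suc (length L)
    x∸m≤ = m≤n+o⇒m∸n≤o x m (begin
      x                       ≤⟨ x≤len ⟩
      length (y ∷ ys)         ≡⟨ cong length eq ⟩
      length (join m L R)     ≡⟨ length-join m L R ⟩
      length L + suc m        ≡⟨ +-comm (length L) (suc m) ⟩
      suc m + length L        ≡⟨ +-suc m (length L) ⟨
      m + suc (length L)      ∎)
      where open ≤-Reasoning
    head≤ : ∀ L → y ∷ ys ≡ join m L R → HeadAtMost (x ∸ m) L
    head≤ []      _  = tt
    head≤ (z ∷ _) eq = m+n≤o⇒m≤o∸n z (subst (_≤ x) (∷-injectiveˡ eq) y≤x)

join-lengths : ∀ {f} m L R → length (join m L R) ≤ suc f → length L ≤ f × length R ≤ f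
join-lengths m L R len≤ with s≤s len≤f ← subst (_≤ _) (trans (length-join m L R) (+-suc (length L) (length R))) len≤ =
  ≤-trans (m≤m+n (length L) (length R)) len≤f , ≤-trans (m≤n+m (length R) (length L)) len≤f

encode-onto : ∀ f xs → length xs ≤ f → Ballot xs → ∃[ t ] encode t ≡ xs
encode-onto _       []       _        _      = leaf , refl
encode-onto (suc f) (x ∷ xs) len≤1+f ballot
  with L , R , ballotL , ballotR , eq ← Ballot-decompose ballot
  with L≤f , R≤f ← join-lengths (length R) L R (subst (λ ys → length ys ≤ suc f) eq len≤1+f)
  with tl , refl ← encode-onto f L L≤f ballotL | tr , refl ← encode-onto f R R≤f ballotR =
  node tl tr , trans (cong (λ m → join m (encode tl) (encode tr)) (sym (length-encode tr))) (sym eq)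

encode-decode : ∀ xs → Ballot xs → encode (decode xs) ≡ xs
encode-decode xs ballot with t , refl ← encode-onto (length xs) xs ≤-refl ballot = cong encode (decode-encode t)

HeadBound-zero : ∀ r L R → Ballot (join r L R) → HeadBound 0 (join r L R)
HeadBound-zero r []      R (_ , bound , _) = ≤-trans (≤-reflexive (+-identityʳ _)) bound
HeadBound-zero r (y ∷ L) R (_ , bound , _) = ≤-trans (≤-reflexive (+-identityʳ _)) bound

HeadBound-join : ∀ m r L R → length R ≡ r → HeadBound (suc m) (join r L R) ⇔ HeadBound m L
HeadBound-join m r []      R refl = mk⇔ (m+1+n≰m (suc r)) λ ()
HeadBound-join m r (y ∷ L) R refl = mk⇔
  (λ bound → +-cancelʳ-≤ (suc r) (y + m) (suc (length L)) (subst₂ _≤_ ([m+n]+1+o≡[m+o]+1+n y r m) (cong suc (length-join r L R)) bound))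
  (λ bound → subst₂ _≤_ (sym ([m+n]+1+o≡[m+o]+1+n y r m)) (sym (cong suc (length-join r L R))) (+-monoˡ-≤ (suc r) bound))

LeftRow⇔HeadBound : ∀ m t → LeftRow m t ⇔ HeadBound m (encode t)
LeftRow⇔HeadBound m       leaf       = mk⇔ (λ ()) (λ ())
LeftRow⇔HeadBound zero    (node l r) = mk⇔ (λ _ → HeadBound-zero (size r) (encode l) (encode r) (Ballot-encode (node l r))) _
LeftRow⇔HeadBound (suc m) (node l r) =
  ⇔-sym (HeadBound-join m (size r) (encode l) (encode r) (length-encode r)) ⇔-∘ LeftRow⇔HeadBound m l

-- RightmostRow (suc m) t : t is nonempty and its rightmost node has at least m left children in a row
RightmostRow : ℕ → Tree → Set
RightmostRow zero    _                   = ⊤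
RightmostRow (suc j) leaf                = ⊥
RightmostRow (suc j) (node a leaf)       = RightmostRow j a
RightmostRow (suc j) (node a (node b c)) = RightmostRow (suc j) (node b c)

encode-node-leaf : ∀ a → encode (node a leaf) ≡ encode a ∷ʳ 1
encode-node-leaf a = cong (_∷ʳ 1) (trans (map-cong +-identityʳ (encode a)) (map-id (encode a)))

RightmostRow⇒encode≡++ones : ∀ j t → RightmostRow j t → ∃[ Y ] encode t ≡ Y ++ ones j
RightmostRow⇒encode≡++ones zero    t                   _   = encode t , sym (++-identityʳ (encode t))
RightmostRow⇒encode≡++ones (suc j) (node a leaf)       row with Y , eq ← RightmostRow⇒encode≡++ones j a row =
  Y , trans (encode-node-leaf a) (trans (cong (_∷ʳ 1) eq) (++-ones-∷ʳ Y j))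
RightmostRow⇒encode≡++ones (suc j) (node a r@(node _ _)) row with Y , eq ← RightmostRow⇒encode≡++ones (suc j) r row =
  map (_+ size r) (encode a) ++ suc (size r) ∷ Y ,
  trans (cong (join (size r) (encode a)) eq) (sym (++-assoc (map (_+ size r) (encode a)) (suc (size r) ∷ Y) (ones (suc j))))

encode≡++ones⇒RightmostRow : ∀ j t Y → encode t ≡ Y ++ ones j → RightmostRow j t
encode≡++ones⇒RightmostRow zero    t                   _ _  = tt
encode≡++ones⇒RightmostRow (suc j) leaf                []      ()
encode≡++ones⇒RightmostRow (suc j) leaf                (_ ∷ _) ()
encode≡++ones⇒RightmostRow (suc j) (node a leaf)       Y eq =
  encode≡++ones⇒RightmostRow j a Y (∷ʳ-injectiveˡ (encode a) (Y ++ ones j)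
    (trans (sym (encode-node-leaf a)) (trans eq (sym (++-ones-∷ʳ Y j)))))
encode≡++ones⇒RightmostRow (suc j) (node a (node b c)) Y eq =
  let Y′ , eq′ = ones-suffix (map (_+ size (node b c)) (encode a)) Y eq (λ ()) in
  encode≡++ones⇒RightmostRow (suc j) (node b c) Y′ eq′

RightmostRow-one : ∀ b c → RightmostRow 1 (node b c)
RightmostRow-one b leaf       = tt
RightmostRow-one b (node c d) = RightmostRow-one c d

IsNode : Tree → Set
IsNode leaf       = ⊥
IsNode (node _ _) = ⊤

HasRightChild : Tree → Set
HasRightChild leaf       = ⊥
HasRightChild (node _ r) = IsNode r

HasRightChild⇔¬Ballot : ∀ t Y → encode t ≡ Y ∷ʳ 1 → HasRightChild t ⇔ (¬ Ballot Y)
HasRightChild⇔¬Ballot leaf                 []      ()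
HasRightChild⇔¬Ballot leaf                 (_ ∷ _) ()
HasRightChild⇔¬Ballot (node a leaf)        Y       eq =
  mk⇔ (λ ()) (λ ¬ballot → ¬ballot (subst Ballot (∷ʳ-injectiveˡ (encode a) Y (trans (sym (encode-node-leaf a)) eq)) (Ballot-encode a)))
HasRightChild⇔¬Ballot (node a r@(node b c)) Y      eq with E , encode-r ← RightmostRow⇒encode≡++ones 1 r (RightmostRow-one b c) =
  mk⇔ (λ _ → ¬ballot) _
  where
  A = map (_+ size r) (encode a)
  Y≡ : A ++ suc (size r) ∷ E ≡ Y
  Y≡ = ∷ʳ-injectiveˡ (A ++ suc (size r) ∷ E) Y (begin
    (A ++ suc (size r) ∷ E) ∷ʳ 1       ≡⟨ ++-assoc A (suc (size r) ∷ E) (1 ∷ []) ⟩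
    join (size r) (encode a) (E ∷ʳ 1)  ≡⟨ cong (join (size r) (encode a)) encode-r ⟨
    encode (node a r)                  ≡⟨ eq ⟩
    Y ∷ʳ 1                             ∎)
    where open ≡-Reasoning
  size-r : size r ≡ length E + 1
  size-r = trans (sym (length-encode r)) (trans (cong length encode-r) (length-++ E))
  ¬ballot : ¬ Ballot Y
  ¬ballot ballot with _ , r≤E , _ ← Ballot-++⁻ʳ A (subst Ballot (sym Y≡) ballot) =
    m+1+n≰m (length E) (subst (_≤ length E) size-r (s≤s⁻¹ r≤E))

-- Reversing right spines, and a rotation

graft : Tree → Tree → Tree
graft leaf       y = y
graft (node a b) y = node a (graft b y)

-- with a tree read as the list of subtrees hanging off its right spine, graft is concatenation and this is reversal
reverseSpines : Tree → Tree
reverseSpines leaf       = leaf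
reverseSpines (node a b) = graft (reverseSpines b) (node (reverseSpines a) leaf)

graft-leafʳ : ∀ x → graft x leaf ≡ x
graft-leafʳ leaf       = refl
graft-leafʳ (node a b) = cong (node a) (graft-leafʳ b)

graft-assoc : ∀ x y z → graft (graft x y) z ≡ graft x (graft y z)
graft-assoc leaf       y z = refl
graft-assoc (node a b) y z = cong (node a) (graft-assoc b y z)

reverseSpines-graft : ∀ x z → reverseSpines (graft x z) ≡ graft (reverseSpines z) (reverseSpines x)
reverseSpines-graft leaf       z = sym (graft-leafʳ (reverseSpines z))
reverseSpines-graft (node a b) z = begin
  graft (reverseSpines (graft b z)) (node (reverseSpines a) leaf)
    ≡⟨ cong (λ w → graft w (node (reverseSpines a) leaf)) (reverseSpines-graft b z) ⟩
  graft (graft (reverseSpines z) (reverseSpines b)) (node (reverseSpines a) leaf)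
    ≡⟨ graft-assoc (reverseSpines z) (reverseSpines b) _ ⟩
  graft (reverseSpines z) (graft (reverseSpines b) (node (reverseSpines a) leaf)) ∎
  where open ≡-Reasoning

reverseSpines-involutive : ∀ t → reverseSpines (reverseSpines t) ≡ t
reverseSpines-involutive leaf       = refl
reverseSpines-involutive (node a b) = begin
  reverseSpines (graft (reverseSpines b) (node (reverseSpines a) leaf))
    ≡⟨ reverseSpines-graft (reverseSpines b) _ ⟩
  graft (node (reverseSpines (reverseSpines a)) leaf) (reverseSpines (reverseSpines b))
    ≡⟨ cong₂ node (reverseSpines-involutive a) (reverseSpines-involutive b) ⟩
  node a b ∎
  where open ≡-Reasoning

size-graft : ∀ x y → size (graft x y) ≡ size x + size y
size-graft leaf       y = refl
size-graft (node a b) y = cong suc (trans (cong (size a +_) (size-graft b y)) (sym (+-assoc (size a) (size b) (size y))))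

size-reverseSpines : ∀ t → size (reverseSpines t) ≡ size t
size-reverseSpines leaf       = refl
size-reverseSpines (node a b) = begin
  size (graft (reverseSpines b) (node (reverseSpines a) leaf))  ≡⟨ size-graft (reverseSpines b) _ ⟩
  size (reverseSpines b) + suc (size (reverseSpines a) + 0)     ≡⟨ cong₂ (λ u v → u + suc (v + 0)) (size-reverseSpines b) (size-reverseSpines a) ⟩
  size b + suc (size a + 0)                                      ≡⟨ cong (λ v → size b + suc v) (+-identityʳ (size a)) ⟩
  size b + suc (size a)                                          ≡⟨ +-comm (size b) (suc (size a)) ⟩
  suc (size a + size b)                                          ∎
  where open ≡-Reasoning

LeftRow-node : ∀ m a b b′ → LeftRow m (node a b) → LeftRow m (node a b′)
LeftRow-node zero    a b b′ _   = tt
LeftRow-node (suc m) a b b′ row = row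

LeftRow-graft : ∀ m x p q q′ → LeftRow m (graft x (node p q)) → LeftRow m (graft x (node p q′))
LeftRow-graft m leaf       p q q′ = LeftRow-node m p q q′
LeftRow-graft m (node a b) p q q′ = LeftRow-node m a _ _

LeftRow-reverseSpines⇔RightmostRow : ∀ m t → LeftRow m (reverseSpines t) ⇔ RightmostRow (suc m) t
LeftRow-reverseSpines⇔RightmostRow m       leaf                = mk⇔ (λ ()) (λ ())
LeftRow-reverseSpines⇔RightmostRow zero    (node a leaf)       = mk⇔ _ _
LeftRow-reverseSpines⇔RightmostRow (suc m) (node a leaf)       = LeftRow-reverseSpines⇔RightmostRow m a
LeftRow-reverseSpines⇔RightmostRow m       (node a (node b c)) =
  LeftRow-reverseSpines⇔RightmostRow m (node b c) ⇔-∘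
  mk⇔ (LeftRow-graft m (reverseSpines c) (reverseSpines b) _ leaf ∘ subst (LeftRow m) regraft)
      (subst (LeftRow m) (sym regraft) ∘ LeftRow-graft m (reverseSpines c) (reverseSpines b) leaf _)
  where
  regraft : reverseSpines (node a (node b c)) ≡ graft (reverseSpines c) (node (reverseSpines b) (node (reverseSpines a) leaf))
  regraft = graft-assoc (reverseSpines c) (node (reverseSpines b) leaf) (node (reverseSpines a) leaf)

RightmostRow-node : ∀ j a v → IsNode v → RightmostRow (suc j) v → RightmostRow (suc j) (node a v)
RightmostRow-node j a (node _ _) _ row = row

IsNode-reverseSpines : ∀ t → IsNode t → IsNode (reverseSpines t)
IsNode-reverseSpines (node a b) _ = IsNode-graft (reverseSpines b)
  where
  IsNode-graft : ∀ x → IsNode (graft x (node (reverseSpines a) leaf))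
  IsNode-graft leaf       = tt
  IsNode-graft (node _ _) = tt

-- rotate and unrotate are only used on trees whose root has a right child, where the fall-through clauses never fire
rotateAt : Tree → Tree → Tree
rotateAt x leaf         = node x leaf
rotateAt x (node y₁ y₂) = node y₁ (node x (reverseSpines y₂))

rotate : Tree → Tree
rotate leaf       = leaf
rotate (node x y) = rotateAt x (reverseSpines y)

unrotate : Tree → Tree
unrotate (node y₁ (node x z)) = node x (reverseSpines (node y₁ (reverseSpines z)))
unrotate t                    = t

size-rotateAt : ∀ x w → IsNode w → size (rotateAt x w) ≡ suc (size x + size w)
size-rotateAt x (node y₁ y₂) _ = cong suc (begin
  size y₁ + suc (size x + size (reverseSpines y₂))  ≡⟨ cong (λ s → size y₁ + suc (size x + s)) (size-reverseSpines y₂) ⟩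
  size y₁ + suc (size x + size y₂)                  ≡⟨ m+1+[n+o]≡n+1+[m+o] (size y₁) (size x) (size y₂) ⟩
  size x + suc (size y₁ + size y₂)                  ∎)
  where open ≡-Reasoning

LeftRow-irrelevant : ∀ m → U.Irrelevant (LeftRow m)
LeftRow-irrelevant m       {leaf}     ()  ()
LeftRow-irrelevant zero    {node _ _} tt  tt = refl
LeftRow-irrelevant (suc m) {node l _}        = LeftRow-irrelevant m {l}

TreeCond-irrelevant : ∀ k → U.Irrelevant (TreeCond k)
TreeCond-irrelevant k {node l (node a b)} =
  ×-irrelevant (LeftRow-irrelevant (k ∸ 1) {node l (node a b)}) (LeftRow-irrelevant k {node a b})

module _ {k′ n : ℕ} where

  private
    k = suc k′

  BallotTree : Tree → Set
  BallotTree t = size t ≡ n + k × LeftRow k t × RightmostRow k t × HasRightChild t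

  SpecialTree : Tree → Set
  SpecialTree t = size t ≡ n + k × TreeCond k t

  SpecialTree-irrelevant : U.Irrelevant SpecialTree
  SpecialTree-irrelevant = ×-irrelevant ≡-irrelevant (TreeCond-irrelevant k)

  rotate-special : ∀ {t} → BallotTree t → SpecialTree (rotate t)
  rotate-special {node x y@(node _ _)} (size≡ , row , rightmost , _) = rotated (reverseSpines y) refl
    where
    rotated : ∀ w → reverseSpines y ≡ w → SpecialTree (rotateAt x w)
    rotated leaf         eq = ⊥-elim (subst IsNode eq (IsNode-reverseSpines y tt))
    rotated (node y₁ y₂) eq =
      trans (size-rotateAt x (node y₁ y₂) tt) (trans (cong (λ w → suc (size x + size w)) (sym eq))
        (trans (cong (λ s → suc (size x + s)) (size-reverseSpines y)) size≡)) ,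
      LeftRow-node k′ y₁ y₂ (node x (reverseSpines y₂))
        (subst (LeftRow k′) eq (Equivalence.from (LeftRow-reverseSpines⇔RightmostRow k′ y) rightmost)) ,
      LeftRow-node k x y (reverseSpines y₂) row

  unrotate-ballot : ∀ {t} → SpecialTree t → BallotTree (unrotate t)
  unrotate-ballot {node y₁ (node x z)} (size≡ , row₁ , row) =
    size≡′ ,
    LeftRow-node k x z (reverseSpines w) row ,
    RightmostRow-node k′ x (reverseSpines w) (IsNode-reverseSpines w tt)
      (Equivalence.to (LeftRow-reverseSpines⇔RightmostRow k′ (reverseSpines w))
        (subst (LeftRow k′) (sym (reverseSpines-involutive w)) (LeftRow-node k′ y₁ (node x z) (reverseSpines z) row₁))) ,
    IsNode-reverseSpines w tt
    where
    w = node y₁ (reverseSpines z)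
    size≡′ : size (node x (reverseSpines w)) ≡ n + k
    size≡′ = begin
      suc (size x + size (reverseSpines w))                     ≡⟨ cong (λ s → suc (size x + s)) (size-reverseSpines w) ⟩
      suc (size x + size w)                                     ≡⟨ size-rotateAt x w tt ⟨
      size (node y₁ (node x (reverseSpines (reverseSpines z)))) ≡⟨ cong (λ z′ → size (node y₁ (node x z′))) (reverseSpines-involutive z) ⟩
      size (node y₁ (node x z))                                 ≡⟨ size≡ ⟩
      n + k                                                     ∎
      where open ≡-Reasoning

  rotate-unrotate : ∀ {t} → SpecialTree t → rotate (unrotate t) ≡ t
  rotate-unrotate {node y₁ (node x z)} _ = begin
    rotateAt x (reverseSpines (reverseSpines (node y₁ (reverseSpines z))))
      ≡⟨ cong (rotateAt x) (reverseSpines-involutive (node y₁ (reverseSpines z))) ⟩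
    node y₁ (node x (reverseSpines (reverseSpines z)))
      ≡⟨ cong (λ z′ → node y₁ (node x z′)) (reverseSpines-involutive z) ⟩
    node y₁ (node x z) ∎
    where open ≡-Reasoning

  unrotate-rotate : ∀ {t} → BallotTree t → unrotate (rotate t) ≡ t
  unrotate-rotate {node x y@(node _ _)} _ = unrotated (reverseSpines y) refl
    where
    unrotated : ∀ w → reverseSpines y ≡ w → unrotate (rotateAt x w) ≡ node x y
    unrotated leaf         eq = ⊥-elim (subst IsNode eq (IsNode-reverseSpines y tt))
    unrotated (node y₁ y₂) eq = cong (node x) (begin
      reverseSpines (node y₁ (reverseSpines (reverseSpines y₂))) ≡⟨ cong (λ v → reverseSpines (node y₁ v)) (reverseSpines-involutive y₂) ⟩
      reverseSpines (node y₁ y₂)                                  ≡⟨ cong reverseSpines eq ⟨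
      reverseSpines (reverseSpines y)                             ≡⟨ reverseSpines-involutive y ⟩
      y                                                           ∎)
      where open ≡-Reasoning

  ballotTree↔special : SubsetInverse BallotTree SpecialTree
  ballotTree↔special = record
    { to = rotate ; from = unrotate
    ; to-pres = rotate-special ; from-pres = unrotate-ballot ; to-from = rotate-unrotate ; from-to = unrotate-rotate }

module _ {k′ n : ℕ} where

  private
    k = suc k′

  DescStrictNaples : Vec ℕ n → Set
  DescStrictNaples a = VecAll.All (λ x → 1 ≤ x × x ≤ n) a × Linked _≥_ (toList a) × T (isStrictlyNaples k n (toList a))

  DescStrictNaples-irrelevant : U.Irrelevant DescStrictNaples
  DescStrictNaples-irrelevant =
    ×-irrelevant (VecAll.irrelevant (×-irrelevant ≤-irrelevant ≤-irrelevant)) (×-irrelevant (Linked.irrelevant ≤-irrelevant) T-irrelevant)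

  StrictNaplesList : List ℕ → Set
  StrictNaplesList l = length l ≡ n × All (λ x → 1 ≤ x × x ≤ n) l × Linked _≥_ l × T (isStrictlyNaples k n l)

  PaddedBallot : List ℕ → Set
  PaddedBallot l = length l ≡ n × Ballot (l ++ ones k) × HeadBound k (l ++ ones k) × ¬ Ballot (l ++ ones k′)

  vec↔list : SubsetInverse DescStrictNaples StrictNaplesList
  vec↔list = record
    { to = toList ; from = toVec n
    ; to-pres = λ {a} (in-range , descending , strict) → length-toList a , VecAll.toList⁺ in-range , descending , strict
    ; from-pres = λ {l} (len , in-range , descending , strict) →
        VecAll.toList⁻ (subst (All _) (sym (toList-toVec l len)) in-range) ,
        subst (λ l → Linked _≥_ l × T (isStrictlyNaples k n l)) (sym (toList-toVec l len)) (descending , strict)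
    ; to-from = λ {l} (len , _) → toList-toVec l len
    ; from-to = λ {a} _ → toVec-toList a
    }

  strict⇔Fits : ∀ l → length l ≡ n → All (λ x → 1 ≤ x × x ≤ n) l → Linked _≥_ l →
                T (isStrictlyNaples k n l) ⇔ (Fits k l × ¬ Fits k′ l)
  strict⇔Fits l len in-range descending = mk⇔
    (λ strict → let k-naples , not-k′-naples = to T-∧ strict in
       to (naples k) k-naples , to T-not⇔¬T not-k′-naples ∘ from (naples k′))
    (λ (fits , ¬fits′) → from T-∧ (from (naples k) fits , from T-not⇔¬T (¬fits′ ∘ to (naples k′))))
    where
    open Equivalence
    naples : ∀ j → T (isNaples j n l) ⇔ Fits j l
    naples j = isNaples⇔Fits l len in-range descending

  StrictNaplesList⇒PaddedBallot : 1 ≤ n → ∀ {l} → StrictNaplesList l → PaddedBallot l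
  StrictNaplesList⇒PaddedBallot 1≤n {l} (len , in-range , descending , strict) =
    let fits , ¬fits′ = to (strict⇔Fits l len in-range descending) strict in
    len ,
    from (Ballot-++-ones k l) (All.map proj₁ in-range , descending , fits) ,
    head-bound l len in-range ,
    ¬fits′ ∘ proj₂ ∘ proj₂ ∘ to (Ballot-++-ones k′ l)
    where
    open Equivalence
    head-bound : ∀ l → length l ≡ n → All (λ x → 1 ≤ x × x ≤ n) l → HeadBound k (l ++ ones k)
    head-bound []      refl _                = contradiction 1≤n (λ ())
    head-bound (x ∷ l) refl ((_ , x≤n) ∷ _) = from (HeadBound-++-ones k x l) x≤n

  PaddedBallot⇒StrictNaplesList : ∀ {l} → PaddedBallot l → StrictNaplesList l
  PaddedBallot⇒StrictNaplesList {l} (len , ballot , bound , ¬ballot′) =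
    let positive , descending , fits = to (Ballot-++-ones k l) ballot
        in-range = All.zip (positive , bounded l len descending bound) in
    len , in-range , descending ,
    from (strict⇔Fits l len in-range descending) (fits , λ fits′ → ¬ballot′ (from (Ballot-++-ones k′ l) (positive , descending , fits′)))
    where
    open Equivalence
    bounded : ∀ l → length l ≡ n → Linked _≥_ l → HeadBound k (l ++ ones k) → All (_≤ n) l
    bounded []      _    _          _     = []
    bounded (x ∷ l) refl descending bound =
      Linked⇒All (λ n≥y y≥z → ≤-trans y≥z n≥y) (to (HeadBound-++-ones k x l) bound) descending

  naples↔paddedBallot : 1 ≤ n → SubsetInverse StrictNaplesList PaddedBallot
  naples↔paddedBallot 1≤n = ⇔⇒SubsetInverse (mk⇔ (StrictNaplesList⇒PaddedBallot 1≤n) PaddedBallot⇒StrictNaplesList)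

  decode-ballotTree : ∀ {l} → PaddedBallot l → BallotTree {k′} {n} (decode (l ++ ones k))
  decode-ballotTree {l} (len , ballot , bound , ¬ballot′) =
    trans (sym (length-encode t)) (trans (cong length encoded) (trans (length-++-ones l k) (cong (_+ k) len))) ,
    from (LeftRow⇔HeadBound k t) (subst (HeadBound k) (sym encoded) bound) ,
    encode≡++ones⇒RightmostRow k t l encoded ,
    from (HasRightChild⇔¬Ballot t (l ++ ones k′) (trans encoded (sym (++-ones-∷ʳ l k′)))) ¬ballot′
    where
    open Equivalence
    t = decode (l ++ ones k)
    encoded : encode t ≡ l ++ ones k
    encoded = encode-decode (l ++ ones k) ballot

  encode-ballotTree : ∀ t → BallotTree {k′} {n} t → ∃[ l ] length l ≡ n × encode t ≡ l ++ ones k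
  encode-ballotTree t (size≡ , _ , rightmost , _) with l , encoded ← RightmostRow⇒encode≡++ones k t rightmost =
    l , +-cancelʳ-≡ k (length l) n (trans (sym (length-++-ones l k)) (trans (cong length (sym encoded)) (trans (length-encode t) size≡))) ,
    encoded

  take-encode-padded : ∀ {t} → BallotTree {k′} {n} t → PaddedBallot (take n (encode t))
  take-encode-padded {t} ballot-tree@(_ , row , _ , right-child)
    with l , refl , encoded ← encode-ballotTree t ballot-tree rewrite encoded | take-++-length l {ones k} =
    refl ,
    subst Ballot encoded (Ballot-encode t) ,
    subst (HeadBound k) encoded (Equivalence.to (LeftRow⇔HeadBound k t) row) ,
    Equivalence.to (HasRightChild⇔¬Ballot t (l ++ ones k′) (trans encoded (sym (++-ones-∷ʳ l k′)))) right-child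

  take-encode-++-ones : ∀ {t} → BallotTree {k′} {n} t → take n (encode t) ++ ones k ≡ encode t
  take-encode-++-ones {t} ballot-tree with l , refl , encoded ← encode-ballotTree t ballot-tree rewrite encoded =
    cong (_++ ones k) (take-++-length l)

  paddedBallot↔ballotTree : SubsetInverse PaddedBallot (BallotTree {k′} {n})
  paddedBallot↔ballotTree = record
    { to        = λ l → decode (l ++ ones k)
    ; from      = λ t → take n (encode t)
    ; to-pres   = decode-ballotTree
    ; from-pres = take-encode-padded
    ; to-from   = λ {t} ballot-tree → trans (cong decode (take-encode-++-ones ballot-tree)) (decode-encode t)
    ; from-to   = λ {l} (len , ballot , _) →
        trans (cong (take n) (encode-decode _ ballot)) (subst (λ m → take m (l ++ ones k) ≡ l) len (take-++-length l))
    }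

proposition4p15 : (k n : ℕ) → 1 ≤ k → 1 ≤ n →
    DescStrictNaplesPF k n ↔ SpecialTrees k n
proposition4p15 (suc k′) n _ 1≤n =
  SubsetInverse⇒↔ DescStrictNaples-irrelevant SpecialTree-irrelevant
    (vec↔list ⨾ naples↔paddedBallot 1≤n ⨾ paddedBallot↔ballotTree ⨾ ballotTree↔special)
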